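{- Let $\mathbf M_1=(S,\mathcal I_1)$ and $\mathbf M_2=(S,\mathcal I_2)$ be matroids and $R$ a fixed maximum-cardinality common independent set. Let $I$ be an inclusion-wise maximal common independent set with $|I|<|R|$, and let $\mathrm{par}(I)=\mu(I\triangle\{v_2,v_3\})$, where $P=(v_1=s,v_2,v_3,\dots,v_{2k+1}=t)$ is a directed $s$-$t$ path without shortcuts in $D(R,I)$ chosen by a fixed rule. Then (i) $|I|\le|\mathrm{par}(I)|$; (ii) $|R\triangle I|>|R\triangle\mathrm{par}(I)|$; (iii) $|I\triangle\mathrm{par}(I)|\le3$.
   Context: For matroids $\mathbf N_1=(T,\mathcal J_1)$, $\mathbf N_2=(T,\mathcal J_2)$ and a common independent set $J$, $D_{\mathbf N_1,\mathbf N_2}(J)$ has vertex set $T\cup\{s,t\}$ and arcs: $(e,f)$ for $e\in J$, $f\in T\setminus J$ with $J\cup\{f\}\notin\mathcal J_1$, $(J\cup\{f\})\setminus\{e\}\in\mathcal J_1$; $(f,e)$ for $e\in J$, $f\in T\setminus J$ with $J\cup\{f\}\notin\mathcal J_2$, $(J\cup\{f\})\setminus\{e\}\in\mathcal J_2$; $(s,f)$ for $f\in T\setminus J$ with $J\cup\{f\}\in\mathcal J_1$; $(f,t)$ for $f\in T\setminus J$ with $J\cup\{f\}\in\mathcal J_2$. $\mathbf M_j(R,I)=(\mathbf M_j|(R\cup I))/(R\cap I)$ is the matroid on $R\triangle I$ in which $Y$ is independent iff $Y\cup(R\cap I)\in\mathcal I_j$, and $D(R,I)=D_{\mathbf M_1(R,I),\mathbf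 M_2(R,I)}(I\setminus R)$ (such an $s$-$t$ path exists). A directed path $(u_1,\dots,u_m)$ is without shortcuts if no arc $(u_i,u_j)$ with $j>i+1$ exists. For a common independent set $X$, $\mu(X)$ denotes a fixed (determined by $X$) inclusion-wise maximal common independent set containing $X$. -}

module Defs where

open import Data.Nat using (ℕ; zero; suc; _<_; _≤_)
open import Data.Bool using (Bool; true; false)
open import Data.Fin using (Fin; toℕ)
open import Data.Fin.Subset using (Subset; ⊥; ⁅_⁆; _∈_; _∉_; _⊆_; _∪_; _∩_; _─_; ∣_∣)
open import Data.List using (List; []; _∷_; length; lookup; last; head)
open import Data.List.Relation.Unary.Unique.Propositional using (Unique)
open import Data.Maybe using (just)
open import Data.Product using (_×_; Σ; ∃)
open import Data.Unit using (⊤)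
open import Relation.Binary.PropositionalEquality using (_≡_)
open import Relation.Nullary using (¬_)

infixl 5 _△_
_△_ : ∀ {n} → Subset n → Subset n → Subset n
X △ Y = (X ─ Y) ∪ (Y ─ X)

record Matroid (n : ℕ) : Set where
  field
    indep     : Subset n → Bool
    indep-⊥   : indep ⊥ ≡ true
    indep-⊆   : ∀ {X Y} → X ⊆ Y → indep Y ≡ true → indep X ≡ true
    indep-aug : ∀ {X Y} → indep X ≡ true → indep Y ≡ true → ∣ X ∣ < ∣ Y ∣ →
                ∃ λ y → y ∈ Y × y ∉ X × indep (X ∪ ⁅ y ⁆) ≡ true
open Matroid public

Ind : ∀ {n} → Matroid n → Subset n → Set
Ind M X = indep M X ≡ true

Common : ∀ {n} → Matroid n → Matroid n → Subset n → Set
Common M₁ M₂ X = Ind M₁ X × Ind M₂ X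

MaximumCommon : ∀ {n} → Matroid n → Matroid n → Subset n → Set
MaximumCommon M₁ M₂ R = Common M₁ M₂ R × (∀ X → Common M₁ M₂ X → ∣ X ∣ ≤ ∣ R ∣)

MaximalCommon : ∀ {n} → Matroid n → Matroid n → Subset n → Set
MaximalCommon M₁ M₂ I = Common M₁ M₂ I × (∀ X → Common M₁ M₂ X → I ⊆ X → X ⊆ I)

data Vertex (n : ℕ) : Set where
  s t : Vertex n
  el  : Fin n → Vertex n

-- The exchange graph D_{N₁,N₂}(J) for matroids N₁, N₂ on the ground set T ⊆ S,
-- given by independence predicates ind₁, ind₂ on subsets of T.
-- (Vertex set T ∪ {s,t}: only elements of T occur in arcs.)
data ExArc {n : ℕ} (T : Subset n) (ind₁ ind₂ : Subset n → Set) (J : Subset n)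
     : Vertex n → Vertex n → Set where
  arc-ef : ∀ {e f} → e ∈ J → f ∈ T → f ∉ J →
           ¬ ind₁ (J ∪ ⁅ f ⁆) → ind₁ ((J ∪ ⁅ f ⁆) ─ ⁅ e ⁆) →
           ExArc T ind₁ ind₂ J (el e) (el f)
  arc-fe : ∀ {e f} → e ∈ J → f ∈ T → f ∉ J →
           ¬ ind₂ (J ∪ ⁅ f ⁆) → ind₂ ((J ∪ ⁅ f ⁆) ─ ⁅ e ⁆) →
           ExArc T ind₁ ind₂ J (el f) (el e)
  arc-sf : ∀ {f} → f ∈ T → f ∉ J → ind₁ (J ∪ ⁅ f ⁆) →
           ExArc T ind₁ ind₂ J s (el f)
  arc-ft : ∀ {f} → f ∈ T → f ∉ J → ind₂ (J ∪ ⁅ f ⁆) →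
           ExArc T ind₁ ind₂ J (el f) t

-- Independence in the minor M(R,I) = (M | (R ∪ I)) / (R ∩ I), a matroid on R △ I:
-- Y ⊆ R △ I is independent iff Y ∪ (R ∩ I) is independent in M.
MinorInd : ∀ {n} → Matroid n → Subset n → Subset n → Subset n → Set
MinorInd M R I Y = Ind M (Y ∪ (R ∩ I))

DArc : ∀ {n} → Matroid n → Matroid n → Subset n → Subset n → Vertex n → Vertex n → Set
DArc M₁ M₂ R I = ExArc (R △ I) (MinorInd M₁ R I) (MinorInd M₂ R I) (I ─ R)

Walk : ∀ {n} → (Vertex n → Vertex n → Set) → List (Vertex n) → Set
Walk A []            = ⊤
Walk A (x ∷ [])      = ⊤
Walk A (x ∷ y ∷ xs)  = A x y × Walk A (y ∷ xs)

STPath : ∀ {n} → (Vertex n → Vertex n → Set) → List (Vertex n) → Set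
STPath A P = head P ≡ just s × last P ≡ just t × Walk A P × Unique P

NoShortcuts : ∀ {n} → (Vertex n → Vertex n → Set) → List (Vertex n) → Set
NoShortcuts A P = ∀ (i j : Fin (length P)) → suc (toℕ i) < toℕ j → ¬ A (lookup P i) (lookup P j)

-- Write f = v₂ ∈ R ∖ I and e = v₃ ∈ I ∖ R.  The arcs (s, f) and (f, e) say that I + f is
-- independent in M₁ but not in M₂, and that X = I − e + f is independent in M₂; so X is a
-- common independent set, and Y = μ X contains X but not e (else I + f ⊆ Y).  Each
-- y ∈ Y ∖ X makes I + y independent in M₂ (augmenting I inside X + y cannot add f), hence,
-- I being maximal, dependent in M₁.  Two such elements y, y′ would let I + f be augmented
-- in M₁ inside X + y + y′ by one of them, so Y ∖ X has at most one element, and the three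
-- estimates are counting.

module Submission where

open import Defs
open import Data.Nat using (ℕ; suc; _+_; _≤_; _<_; z≤n; s≤s)
open import Data.Nat.Properties
  using (≤-trans; ≤-reflexive; n≤1+n; +-suc; +-monoʳ-≤; +-monoʳ-<; +-mono-≤; module ≤-Reasoning)
open import Data.Fin using (Fin; _≟_)
open import Data.Fin.Subset
  using (Subset; ⊥; inside; outside; _∈_; _∉_; _⊆_; _∪_; _∩_; _─_; ⁅_⁆; ∣_∣)
open import Data.Fin.Subset.Properties
open import Data.List using (List; _∷_)
open import Data.Product using (_×_; _,_; proj₁; proj₂; ∃)
open import Data.Sum as Sum using (_⊎_; inj₁; inj₂)
open import Data.Vec using ([]; _∷_; here; there)
open import Data.Empty using (⊥-elim)
open import Function using (_∘_; case_of_)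
open import Relation.Nullary using (¬_; yes; no)
open import Relation.Binary.PropositionalEquality
  using (_≡_; _≢_; refl; sym; trans; cong; subst; module ≡-Reasoning)

x∈p─q⁻ : ∀ {n} (p q : Subset n) {x} → x ∈ p ─ q → x ∈ p × x ∉ q
x∈p─q⁻ p q x∈p─q = p─q⊆p p q x∈p─q , x∈p─q⇒x∉q p q x∈p─q
  where
  x∈p─q⇒x∉q : ∀ {n} (p q : Subset n) {x} → x ∈ p ─ q → x ∉ q
  x∈p─q⇒x∉q (inside ∷ p) (outside ∷ q) here ()
  x∈p─q⇒x∉q (_ ∷ p) (_ ∷ q) (there x∈p─q) (there x∈q) = x∈p─q⇒x∉q p q x∈p─q x∈q

x∈p△q⁻ : ∀ {n} (p q : Subset n) {x} → x ∈ p △ q → (x ∈ p × x ∉ q) ⊎ (x ∈ q × x ∉ p)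
x∈p△q⁻ p q x∈p△q = Sum.map (x∈p─q⁻ p q) (x∈p─q⁻ q p) (x∈p∪q⁻ (p ─ q) (q ─ p) x∈p△q)

x∈p△q⁺ˡ : ∀ {n} {p q : Subset n} {x} → x ∈ p → x ∉ q → x ∈ p △ q
x∈p△q⁺ˡ x∈p x∉q = x∈p∪q⁺ (inj₁ (x∈p∧x∉q⇒x∈p─q x∈p x∉q))

x∈p△q⁺ʳ : ∀ {n} {p q : Subset n} {x} → x ∈ q → x ∉ p → x ∈ p △ q
x∈p△q⁺ʳ x∈q x∉p = x∈p∪q⁺ (inj₂ (x∈p∧x∉q⇒x∈p─q x∈q x∉p))

x∈p∧x∈q⇒x∉p△q : ∀ {n} {p q : Subset n} {x} → x ∈ p → x ∈ q → x ∉ p △ q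
x∈p∧x∈q⇒x∉p△q {p = p} {q} x∈p x∈q x∈p△q with x∈p△q⁻ p q x∈p△q
... | inj₁ (_ , x∉q) = x∉q x∈q
... | inj₂ (_ , x∉p) = x∉p x∈p

x∉p∧x∉q⇒x∉p△q : ∀ {n} {p q : Subset n} {x} → x ∉ p → x ∉ q → x ∉ p △ q
x∉p∧x∉q⇒x∉p△q {p = p} {q} x∉p x∉q x∈p△q with x∈p△q⁻ p q x∈p△q
... | inj₁ (x∈p , _) = x∉p x∈p
... | inj₂ (x∈q , _) = x∉q x∈q

p⊆r∧q⊆r⇒p∪q⊆r : ∀ {n} {p q r : Subset n} → p ⊆ r → q ⊆ r → p ∪ q ⊆ r
p⊆r∧q⊆r⇒p∪q⊆r {p = p} {q} p⊆r q⊆r x∈p∪q with x∈p∪q⁻ p q x∈p∪q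
... | inj₁ x∈p = p⊆r x∈p
... | inj₂ x∈q = q⊆r x∈q

x∈p⇒⁅x⁆⊆p : ∀ {n} {p : Subset n} {x} → x ∈ p → ⁅ x ⁆ ⊆ p
x∈p⇒⁅x⁆⊆p {p = p} {x = x} x∈p y∈⁅x⁆ = subst (_∈ p) (sym (x∈⁅y⁆⇒x≡y x y∈⁅x⁆)) x∈p

p─q∪q∩p≡p : ∀ {n} (p q : Subset n) → (p ─ q) ∪ (q ∩ p) ≡ p
p─q∪q∩p≡p []            []            = refl
p─q∪q∩p≡p (inside  ∷ p) (inside  ∷ q) = cong (inside ∷_) (p─q∪q∩p≡p p q)
p─q∪q∩p≡p (inside  ∷ p) (outside ∷ q) = cong (inside ∷_) (p─q∪q∩p≡p p q)
p─q∪q∩p≡p (outside ∷ p) (inside  ∷ q) = cong (outside ∷_) (p─q∪q∩p≡p p q)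
p─q∪q∩p≡p (outside ∷ p) (outside ∷ q) = cong (outside ∷_) (p─q∪q∩p≡p p q)

∣p∣≡∣p∩q∣+∣p─q∣ : ∀ {n} (p q : Subset n) → ∣ p ∣ ≡ ∣ p ∩ q ∣ + ∣ p ─ q ∣
∣p∣≡∣p∩q∣+∣p─q∣ []            []            = refl
∣p∣≡∣p∩q∣+∣p─q∣ (outside ∷ p) (inside  ∷ q) = ∣p∣≡∣p∩q∣+∣p─q∣ p q
∣p∣≡∣p∩q∣+∣p─q∣ (outside ∷ p) (outside ∷ q) = ∣p∣≡∣p∩q∣+∣p─q∣ p q
∣p∣≡∣p∩q∣+∣p─q∣ (inside  ∷ p) (inside  ∷ q) = cong suc (∣p∣≡∣p∩q∣+∣p─q∣ p q)
∣p∣≡∣p∩q∣+∣p─q∣ (inside  ∷ p) (outside ∷ q) =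
  trans (cong suc (∣p∣≡∣p∩q∣+∣p─q∣ p q)) (sym (+-suc ∣ p ∩ q ∣ ∣ p ─ q ∣))

∣p∪q∣≤∣p∣+∣q∣ : ∀ {n} (p q : Subset n) → ∣ p ∪ q ∣ ≤ ∣ p ∣ + ∣ q ∣
∣p∪q∣≤∣p∣+∣q∣ []            []            = z≤n
∣p∪q∣≤∣p∣+∣q∣ (outside ∷ p) (outside ∷ q) = ∣p∪q∣≤∣p∣+∣q∣ p q
∣p∪q∣≤∣p∣+∣q∣ (outside ∷ p) (inside  ∷ q) =
  ≤-trans (s≤s (∣p∪q∣≤∣p∣+∣q∣ p q)) (≤-reflexive (sym (+-suc ∣ p ∣ ∣ q ∣)))
∣p∪q∣≤∣p∣+∣q∣ (inside  ∷ p) (outside ∷ q) = s≤s (∣p∪q∣≤∣p∣+∣q∣ p q)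
∣p∪q∣≤∣p∣+∣q∣ (inside  ∷ p) (inside  ∷ q) =
  s≤s (≤-trans (∣p∪q∣≤∣p∣+∣q∣ p q) (+-monoʳ-≤ ∣ p ∣ (n≤1+n ∣ q ∣)))

∣p─q∣≤∣q─p∣⇒∣p∣≤∣q∣ : ∀ {n} (p q : Subset n) → ∣ p ─ q ∣ ≤ ∣ q ─ p ∣ → ∣ p ∣ ≤ ∣ q ∣
∣p─q∣≤∣q─p∣⇒∣p∣≤∣q∣ p q ∣p─q∣≤∣q─p∣ = begin
  ∣ p ∣                  ≡⟨ ∣p∣≡∣p∩q∣+∣p─q∣ p q ⟩
  ∣ p ∩ q ∣ + ∣ p ─ q ∣  ≤⟨ +-monoʳ-≤ ∣ p ∩ q ∣ ∣p─q∣≤∣q─p∣ ⟩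
  ∣ p ∩ q ∣ + ∣ q ─ p ∣  ≡⟨ cong (λ r → ∣ r ∣ + ∣ q ─ p ∣) (∩-comm p q) ⟩
  ∣ q ∩ p ∣ + ∣ q ─ p ∣  ≡⟨ ∣p∣≡∣p∩q∣+∣p─q∣ q p ⟨
  ∣ q ∣                  ∎
  where open ≤-Reasoning

∣p─q∣<∣q─p∣⇒∣p∣<∣q∣ : ∀ {n} (p q : Subset n) → ∣ p ─ q ∣ < ∣ q ─ p ∣ → ∣ p ∣ < ∣ q ∣
∣p─q∣<∣q─p∣⇒∣p∣<∣q∣ p q ∣p─q∣<∣q─p∣ = begin-strict
  ∣ p ∣                  ≡⟨ ∣p∣≡∣p∩q∣+∣p─q∣ p q ⟩
  ∣ p ∩ q ∣ + ∣ p ─ q ∣  <⟨ +-monoʳ-< ∣ p ∩ q ∣ ∣p─q∣<∣q─p∣ ⟩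
  ∣ p ∩ q ∣ + ∣ q ─ p ∣  ≡⟨ cong (λ r → ∣ r ∣ + ∣ q ─ p ∣) (∩-comm p q) ⟩
  ∣ q ∩ p ∣ + ∣ q ─ p ∣  ≡⟨ ∣p∣≡∣p∩q∣+∣p─q∣ q p ⟨
  ∣ q ∣                  ∎
  where open ≤-Reasoning

p⊆⁅x⁆⇒∣p∣≤1 : ∀ {n} {p : Subset n} {x} → p ⊆ ⁅ x ⁆ → ∣ p ∣ ≤ 1
p⊆⁅x⁆⇒∣p∣≤1 {x = x} p⊆⁅x⁆ = ≤-trans (p⊆q⇒∣p∣≤∣q∣ p⊆⁅x⁆) (≤-reflexive (∣⁅x⁆∣≡1 x))

x∈p⇒1≤∣p∣ : ∀ {n} {p : Subset n} {x} → x ∈ p → 1 ≤ ∣ p ∣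
x∈p⇒1≤∣p∣ {x = x} x∈p = ≤-trans (≤-reflexive (sym (∣⁅x⁆∣≡1 x))) (p⊆q⇒∣p∣≤∣q∣ (x∈p⇒⁅x⁆⊆p x∈p))

x∈p∧y∈p∧x≢y⇒2≤∣p∣ : ∀ {n} {p : Subset n} {x y} → x ∈ p → y ∈ p → x ≢ y → 2 ≤ ∣ p ∣
x∈p∧y∈p∧x≢y⇒2≤∣p∣ {x = x} x∈p y∈p x≢y =
  subst (_< _) (∣⁅x⁆∣≡1 x)
    (p⊂q⇒∣p∣<∣q∣ (x∈p⇒⁅x⁆⊆p x∈p , _ , y∈p , λ y∈⁅x⁆ → x≢y (sym (x∈⁅y⁆⇒x≡y x y∈⁅x⁆))))

subsingleton⇒∣p∣≤1 : ∀ {n} (p : Subset n) → (∀ {x y} → x ∈ p → y ∈ p → x ≡ y) → ∣ p ∣ ≤ 1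
subsingleton⇒∣p∣≤1 {n} p unique with nonempty? p
... | yes (x , x∈p) = p⊆⁅x⁆⇒∣p∣≤1 (λ y∈p → subst (_∈ ⁅ x ⁆) (unique x∈p y∈p) (x∈⁅x⁆ x))
... | no  p-empty   = ≤-trans (p⊆q⇒∣p∣≤∣q∣ {q = ⊥} (λ x∈p → ⊥-elim (p-empty (_ , x∈p))))
                                (≤-trans (≤-reflexive (∣⊥∣≡0 n)) z≤n)

∣p─q∣≤1∧x∈q─p⇒∣p∣≤∣q∣ : ∀ {n} {p q : Subset n} {x} → ∣ p ─ q ∣ ≤ 1 → x ∈ q ─ p → ∣ p ∣ ≤ ∣ q ∣
∣p─q∣≤1∧x∈q─p⇒∣p∣≤∣q∣ {p = p} {q} ∣p─q∣≤1 x∈q─p =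
  ∣p─q∣≤∣q─p∣⇒∣p∣≤∣q∣ p q (≤-trans ∣p─q∣≤1 (x∈p⇒1≤∣p∣ x∈q─p))

∣p─q∣≤1∧x,y∈q─p⇒∣p∣<∣q∣ : ∀ {n} {p q : Subset n} {x y} →
  ∣ p ─ q ∣ ≤ 1 → x ∈ q ─ p → y ∈ q ─ p → x ≢ y → ∣ p ∣ < ∣ q ∣
∣p─q∣≤1∧x,y∈q─p⇒∣p∣<∣q∣ {p = p} {q} ∣p─q∣≤1 x∈q─p y∈q─p x≢y =
  ∣p─q∣<∣q─p∣⇒∣p∣<∣q∣ p q (≤-trans (s≤s ∣p─q∣≤1) (x∈p∧y∈p∧x≢y⇒2≤∣p∣ x∈q─p y∈q─p x≢y))

maximal⇒¬common-extension : ∀ {n} (M₁ M₂ : Matroid n) {I : Subset n} {y} →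
  MaximalCommon M₁ M₂ I → y ∉ I → ¬ Common M₁ M₂ (I ∪ ⁅ y ⁆)
maximal⇒¬common-extension _ _ {y = y} (_ , I-maximal) y∉I I+y-common =
  y∉I (I-maximal _ I+y-common (p⊆p∪q ⁅ y ⁆) (q⊆p∪q _ ⁅ y ⁆ (x∈⁅x⁆ y)))

module Swap {n} {I : Subset n} {f e : Fin n} (f∉I : f ∉ I) (e∈I : e ∈ I) where

  X : Subset n
  X = I △ (⁅ f ⁆ ∪ ⁅ e ⁆)

  f≢e : f ≢ e
  f≢e refl = f∉I e∈I

  ∈X⁻ : ∀ {x} → x ∈ X → (x ∈ I × x ≢ e) ⊎ x ≡ f
  ∈X⁻ x∈X with x∈p△q⁻ I (⁅ f ⁆ ∪ ⁅ e ⁆) x∈X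
  ... | inj₁ (x∈I , x∉fe) = inj₁ (x∈I , x∉⁅y⁆⇒x≢y (x∉fe ∘ q⊆p∪q ⁅ f ⁆ ⁅ e ⁆))
  ... | inj₂ (x∈fe , x∉I) with x∈p∪q⁻ ⁅ f ⁆ ⁅ e ⁆ x∈fe
  ...   | inj₁ x∈⁅f⁆ = inj₂ (x∈⁅y⁆⇒x≡y f x∈⁅f⁆)
  ...   | inj₂ x∈⁅e⁆ = ⊥-elim (x∉I (subst (_∈ I) (sym (x∈⁅y⁆⇒x≡y e x∈⁅e⁆)) e∈I))

  f∈X : f ∈ X
  f∈X = x∈p△q⁺ʳ (p⊆p∪q ⁅ e ⁆ (x∈⁅x⁆ f)) f∉I

  ∈I∪⁅f⁆∧≢e⇒∈X : ∀ {x} → x ∈ I ∪ ⁅ f ⁆ → x ≢ e → x ∈ X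
  ∈I∪⁅f⁆∧≢e⇒∈X {x} x∈I+f x≢e with x∈p∪q⁻ I ⁅ f ⁆ x∈I+f
  ... | inj₁ x∈I   = x∈p△q⁺ˡ x∈I x∉fe
    where
    x∉fe : x ∉ ⁅ f ⁆ ∪ ⁅ e ⁆
    x∉fe x∈fe with x∈p∪q⁻ ⁅ f ⁆ ⁅ e ⁆ x∈fe
    ... | inj₁ x∈⁅f⁆ = f∉I (subst (_∈ I) (x∈⁅y⁆⇒x≡y f x∈⁅f⁆) x∈I)
    ... | inj₂ x∈⁅e⁆ = x≢e (x∈⁅y⁆⇒x≡y e x∈⁅e⁆)
  ... | inj₂ x∈⁅f⁆ = subst (_∈ X) (sym (x∈⁅y⁆⇒x≡y f x∈⁅f⁆)) f∈X

  X⊆I∪⁅f⁆ : X ⊆ I ∪ ⁅ f ⁆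
  X⊆I∪⁅f⁆ x∈X with ∈X⁻ x∈X
  ... | inj₁ (x∈I , _) = p⊆p∪q ⁅ f ⁆ x∈I
  ... | inj₂ refl      = q⊆p∪q I ⁅ f ⁆ (x∈⁅x⁆ f)

  I∪⁅f⁆─Z⊆⁅e⁆ : ∀ {Z} → X ⊆ Z → (I ∪ ⁅ f ⁆) ─ Z ⊆ ⁅ e ⁆
  I∪⁅f⁆─Z⊆⁅e⁆ {Z} X⊆Z {x} x∈I+f─Z with x∈p─q⁻ (I ∪ ⁅ f ⁆) Z x∈I+f─Z | x ≟ e
  ... | _             | yes refl = x∈⁅x⁆ e
  ... | x∈I+f , x∉Z  | no  x≢e  = ⊥-elim (x∉Z (X⊆Z (∈I∪⁅f⁆∧≢e⇒∈X x∈I+f x≢e)))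

  I─Z⊆⁅e⁆ : ∀ {Z} → X ⊆ Z → I ─ Z ⊆ ⁅ e ⁆
  I─Z⊆⁅e⁆ {Z} X⊆Z x∈I─Z with x∈p─q⁻ I Z x∈I─Z
  ... | x∈I , x∉Z = I∪⁅f⁆─Z⊆⁅e⁆ X⊆Z (x∈p∧x∉q⇒x∈p─q (p⊆p∪q ⁅ f ⁆ x∈I) x∉Z)

  X⊆minor-exchange : ∀ R → X ⊆ (((I ─ R) ∪ ⁅ f ⁆) ─ ⁅ e ⁆) ∪ (R ∩ I)
  X⊆minor-exchange R {x} x∈X with ∈X⁻ x∈X
  ... | inj₂ refl = p⊆p∪q (R ∩ I) (x∈p∧x≢y⇒x∈p-y (q⊆p∪q (I ─ R) ⁅ f ⁆ (x∈⁅x⁆ f)) f≢e)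
  ... | inj₁ (x∈I , x≢e) with x ∈? R
  ...   | yes x∈R = q⊆p∪q _ (R ∩ I) (x∈p∩q⁺ (x∈R , x∈I))
  ...   | no  x∉R = p⊆p∪q (R ∩ I) (x∈p∧x≢y⇒x∈p-y (p⊆p∪q ⁅ f ⁆ (x∈p∧x∉q⇒x∈p─q x∈I x∉R)) x≢e)

module SingleExchange {n} (M₁ M₂ : Matroid n) {I : Subset n} (I-maximal : MaximalCommon M₁ M₂ I)
  {f e : Fin n} (f∉I : f ∉ I) (e∈I : e ∈ I)
  (I+f∈₁ : Ind M₁ (I ∪ ⁅ f ⁆)) (I+f∉₂ : ¬ Ind M₂ (I ∪ ⁅ f ⁆))
  {Y : Subset n} (Y-common : Common M₁ M₂ Y) (X⊆Y : Swap.X f∉I e∈I ⊆ Y) where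

  open Swap f∉I e∈I

  e∉Y : e ∉ Y
  e∉Y e∈Y = I+f∉₂ (indep-⊆ M₂ I∪⁅f⁆⊆Y (proj₂ Y-common))
    where
    I∪⁅f⁆⊆Y : I ∪ ⁅ f ⁆ ⊆ Y
    I∪⁅f⁆⊆Y {x} x∈I+f with x ∈? Y
    ... | yes x∈Y = x∈Y
    ... | no  x∉Y = subst (_∈ Y) (sym (x∈⁅y⁆⇒x≡y e (I∪⁅f⁆─Z⊆⁅e⁆ X⊆Y (x∈p∧x∉q⇒x∈p─q x∈I+f x∉Y)))) e∈Y

  extra∉I∪⁅f⁆ : ∀ {y} → y ∈ Y ─ X → y ∉ I ∪ ⁅ f ⁆
  extra∉I∪⁅f⁆ y∈Y─X y∈I+f with x∈p─q⁻ Y X y∈Y─X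
  ... | y∈Y , y∉X =
    e∉Y (subst (_∈ Y) (x∈⁅y⁆⇒x≡y e (I∪⁅f⁆─Z⊆⁅e⁆ ⊆-refl (x∈p∧x∉q⇒x∈p─q y∈I+f y∉X))) y∈Y)

  extra∉I : ∀ {y} → y ∈ Y ─ X → y ∉ I
  extra∉I y∈Y─X = extra∉I∪⁅f⁆ y∈Y─X ∘ p⊆p∪q ⁅ f ⁆

  extra⇒I+y∈₂ : ∀ {y} → y ∈ Y ─ X → Ind M₂ (I ∪ ⁅ y ⁆)
  extra⇒I+y∈₂ {y} y∈Y─X
    with indep-aug M₂ (proj₂ (proj₁ I-maximal)) (indep-⊆ M₂ X∪⁅y⁆⊆Y (proj₂ Y-common)) ∣I∣<∣X∪⁅y⁆∣
    where
    X∪⁅y⁆⊆Y : X ∪ ⁅ y ⁆ ⊆ Y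
    X∪⁅y⁆⊆Y = p⊆r∧q⊆r⇒p∪q⊆r X⊆Y (x∈p⇒⁅x⁆⊆p (proj₁ (x∈p─q⁻ Y X y∈Y─X)))
    ∣I∣<∣X∪⁅y⁆∣ : ∣ I ∣ < ∣ X ∪ ⁅ y ⁆ ∣
    ∣I∣<∣X∪⁅y⁆∣ = ∣p─q∣≤1∧x,y∈q─p⇒∣p∣<∣q∣ (p⊆⁅x⁆⇒∣p∣≤1 (I─Z⊆⁅e⁆ (p⊆p∪q ⁅ y ⁆)))
      (x∈p∧x∉q⇒x∈p─q (p⊆p∪q ⁅ y ⁆ f∈X) f∉I)
      (x∈p∧x∉q⇒x∈p─q (q⊆p∪q X ⁅ y ⁆ (x∈⁅x⁆ y)) (extra∉I y∈Y─X))
      (λ f≡y → extra∉I∪⁅f⁆ y∈Y─X (q⊆p∪q I ⁅ f ⁆ (subst (_∈ ⁅ f ⁆) f≡y (x∈⁅x⁆ f))))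
  ... | z , z∈X∪⁅y⁆ , z∉I , I+z∈₂ with x∈p∪q⁻ X ⁅ y ⁆ z∈X∪⁅y⁆
  ...   | inj₂ z∈⁅y⁆ = subst (λ w → Ind M₂ (I ∪ ⁅ w ⁆)) (x∈⁅y⁆⇒x≡y y z∈⁅y⁆) I+z∈₂
  ...   | inj₁ z∈X with ∈X⁻ z∈X
  ...     | inj₁ (z∈I , _) = ⊥-elim (z∉I z∈I)
  ...     | inj₂ refl      = ⊥-elim (I+f∉₂ I+z∈₂)

  two-extras⇒I+y∈₁ : ∀ {a b} → a ∈ Y ─ X → b ∈ Y ─ X → a ≢ b →
                     ∃ λ y → y ∈ Y ─ X × Ind M₁ (I ∪ ⁅ y ⁆)
  two-extras⇒I+y∈₁ {a} {b} a∈Y─X b∈Y─X a≢b =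
    case indep-aug M₁ I+f∈₁ (indep-⊆ M₁ X+a+b⊆Y (proj₁ Y-common)) ∣I∪⁅f⁆∣<∣X+a+b∣ of λ where
      (y , y∈X+a+b , y∉I+f , I+f+y∈₁) →
        y , x∈p∧x∉q⇒x∈p─q (X+a+b⊆Y y∈X+a+b) (y∉I+f ∘ X⊆I∪⁅f⁆) ,
        indep-⊆ M₁ (p⊆r∧q⊆r⇒p∪q⊆r (p⊆p∪q ⁅ y ⁆ ∘ p⊆p∪q ⁅ f ⁆) (q⊆p∪q _ ⁅ y ⁆)) I+f+y∈₁
    where
    X+a+b⊆Y : X ∪ (⁅ a ⁆ ∪ ⁅ b ⁆) ⊆ Y
    X+a+b⊆Y = p⊆r∧q⊆r⇒p∪q⊆r X⊆Y (p⊆r∧q⊆r⇒p∪q⊆r (x∈p⇒⁅x⁆⊆p (proj₁ (x∈p─q⁻ Y X a∈Y─X)))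
                                                (x∈p⇒⁅x⁆⊆p (proj₁ (x∈p─q⁻ Y X b∈Y─X))))
    ∣I∪⁅f⁆∣<∣X+a+b∣ : ∣ I ∪ ⁅ f ⁆ ∣ < ∣ X ∪ (⁅ a ⁆ ∪ ⁅ b ⁆) ∣
    ∣I∪⁅f⁆∣<∣X+a+b∣ = ∣p─q∣≤1∧x,y∈q─p⇒∣p∣<∣q∣ (p⊆⁅x⁆⇒∣p∣≤1 (I∪⁅f⁆─Z⊆⁅e⁆ (p⊆p∪q (⁅ a ⁆ ∪ ⁅ b ⁆))))
      (x∈p∧x∉q⇒x∈p─q (q⊆p∪q X _ (p⊆p∪q ⁅ b ⁆ (x∈⁅x⁆ a))) (extra∉I∪⁅f⁆ a∈Y─X))
      (x∈p∧x∉q⇒x∈p─q (q⊆p∪q X _ (q⊆p∪q ⁅ a ⁆ ⁅ b ⁆ (x∈⁅x⁆ b))) (extra∉I∪⁅f⁆ b∈Y─X))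
      a≢b

  Y─X-subsingleton : ∀ {a b} → a ∈ Y ─ X → b ∈ Y ─ X → a ≡ b
  Y─X-subsingleton {a} {b} a∈Y─X b∈Y─X with a ≟ b
  ... | yes a≡b = a≡b
  ... | no  a≢b with two-extras⇒I+y∈₁ a∈Y─X b∈Y─X a≢b
  ...   | y , y∈Y─X , I+y∈₁ =
    ⊥-elim (maximal⇒¬common-extension M₁ M₂ I-maximal (extra∉I y∈Y─X) (I+y∈₁ , extra⇒I+y∈₂ y∈Y─X))

  ∣Y─X∣≤1 : ∣ Y ─ X ∣ ≤ 1
  ∣Y─X∣≤1 = subsingleton⇒∣p∣≤1 (Y ─ X) Y─X-subsingleton

  ∣I∣≤∣Y∣ : ∣ I ∣ ≤ ∣ Y ∣
  ∣I∣≤∣Y∣ = ∣p─q∣≤1∧x∈q─p⇒∣p∣≤∣q∣ (p⊆⁅x⁆⇒∣p∣≤1 (I─Z⊆⁅e⁆ X⊆Y)) (x∈p∧x∉q⇒x∈p─q (X⊆Y f∈X) f∉I)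

  ∣R△Y∣<∣R△I∣ : ∀ {R} → f ∈ R → e ∉ R → ∣ R △ Y ∣ < ∣ R △ I ∣
  ∣R△Y∣<∣R△I∣ {R} f∈R e∉R = ∣p─q∣≤1∧x,y∈q─p⇒∣p∣<∣q∣
    (≤-trans (p⊆q⇒∣p∣≤∣q∣ R△Y─R△I⊆Y─X) ∣Y─X∣≤1)
    (x∈p∧x∉q⇒x∈p─q (x∈p△q⁺ˡ f∈R f∉I) (x∈p∧x∈q⇒x∉p△q f∈R (X⊆Y f∈X)))
    (x∈p∧x∉q⇒x∈p─q (x∈p△q⁺ʳ e∈I e∉R) (x∉p∧x∉q⇒x∉p△q e∉R e∉Y))
    f≢e
    where
    R△Y─R△I⊆Y─X : (R △ Y) ─ (R △ I) ⊆ Y ─ X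
    R△Y─R△I⊆Y─X {x} x∈ with x∈p─q⁻ (R △ Y) (R △ I) x∈
    ... | x∈R△Y , x∉R△I with x∈p△q⁻ R Y x∈R△Y | x ∈? I
    ...   | inj₁ (x∈R , _)   | no  x∉I = ⊥-elim (x∉R△I (x∈p△q⁺ˡ x∈R x∉I))
    ...   | inj₁ (x∈R , x∉Y) | yes x∈I =
      ⊥-elim (e∉R (subst (_∈ R) (x∈⁅y⁆⇒x≡y e (I─Z⊆⁅e⁆ X⊆Y (x∈p∧x∉q⇒x∈p─q x∈I x∉Y))) x∈R))
    ...   | inj₂ (_ , x∉R)   | yes x∈I = ⊥-elim (x∉R△I (x∈p△q⁺ʳ x∈I x∉R))
    ...   | inj₂ (x∈Y , x∉R) | no  x∉I = x∈p∧x∉q⇒x∈p─q x∈Y x∉X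
      where
      x∉X : x ∉ X
      x∉X x∈X with ∈X⁻ x∈X
      ... | inj₁ (x∈I , _) = x∉I x∈I
      ... | inj₂ refl      = x∉R f∈R

  ∣I△Y∣≤3 : ∣ I △ Y ∣ ≤ 3
  ∣I△Y∣≤3 = begin
    ∣ (I ─ Y) ∪ (Y ─ I) ∣               ≤⟨ ∣p∪q∣≤∣p∣+∣q∣ (I ─ Y) (Y ─ I) ⟩
    ∣ I ─ Y ∣ + ∣ Y ─ I ∣               ≤⟨ +-monoʳ-≤ ∣ I ─ Y ∣ (p⊆q⇒∣p∣≤∣q∣ Y─I⊆⁅f⁆∪Y─X) ⟩
    ∣ I ─ Y ∣ + ∣ ⁅ f ⁆ ∪ (Y ─ X) ∣     ≤⟨ +-monoʳ-≤ ∣ I ─ Y ∣ (∣p∪q∣≤∣p∣+∣q∣ ⁅ f ⁆ (Y ─ X)) ⟩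
    ∣ I ─ Y ∣ + (∣ ⁅ f ⁆ ∣ + ∣ Y ─ X ∣) ≤⟨ +-mono-≤ (p⊆⁅x⁆⇒∣p∣≤1 (I─Z⊆⁅e⁆ X⊆Y))
                                             (+-mono-≤ (≤-reflexive (∣⁅x⁆∣≡1 f)) ∣Y─X∣≤1) ⟩
    3                                    ∎
    where
    open ≤-Reasoning
    Y─I⊆⁅f⁆∪Y─X : Y ─ I ⊆ ⁅ f ⁆ ∪ (Y ─ X)
    Y─I⊆⁅f⁆∪Y─X {x} x∈Y─I with x∈p─q⁻ Y I x∈Y─I | x ∈? X
    ... | x∈Y , _   | no  x∉X = q⊆p∪q ⁅ f ⁆ _ (x∈p∧x∉q⇒x∈p─q x∈Y x∉X)
    ... | _ , x∉I   | yes x∈X with ∈X⁻ x∈X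
    ...   | inj₁ (x∈I , _) = ⊥-elim (x∉I x∈I)
    ...   | inj₂ refl      = p⊆p∪q (Y ─ X) (x∈⁅x⁆ f)

module _ {n} {T J : Subset n} {ind₁ ind₂ : Subset n → Set} where

  source-arc⁻ : ∀ {f} → ExArc T ind₁ ind₂ J s (el f) → f ∈ T × f ∉ J × ind₁ (J ∪ ⁅ f ⁆)
  source-arc⁻ (arc-sf f∈T f∉J J+f∈₁) = f∈T , f∉J , J+f∈₁

  exchange-arc⁻ : ∀ {f e} → f ∉ J → ExArc T ind₁ ind₂ J (el f) (el e) →
                  e ∈ J × ¬ ind₂ (J ∪ ⁅ f ⁆) × ind₂ ((J ∪ ⁅ f ⁆) ─ ⁅ e ⁆)
  exchange-arc⁻ f∉J (arc-ef f∈J _ _ _ _)           = ⊥-elim (f∉J f∈J)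
  exchange-arc⁻ _   (arc-fe e∈J _ _ J+f∉₂ J+f-e∈₂) = e∈J , J+f∉₂ , J+f-e∈₂

minor-extension : ∀ {n} (R I : Subset n) f → ((I ─ R) ∪ ⁅ f ⁆) ∪ (R ∩ I) ≡ I ∪ ⁅ f ⁆
minor-extension R I f = begin
  ((I ─ R) ∪ ⁅ f ⁆) ∪ (R ∩ I)  ≡⟨ ∪-assoc (I ─ R) ⁅ f ⁆ (R ∩ I) ⟩
  (I ─ R) ∪ (⁅ f ⁆ ∪ (R ∩ I))  ≡⟨ cong ((I ─ R) ∪_) (∪-comm ⁅ f ⁆ (R ∩ I)) ⟩
  (I ─ R) ∪ ((R ∩ I) ∪ ⁅ f ⁆)  ≡⟨ ∪-assoc (I ─ R) (R ∩ I) ⁅ f ⁆ ⟨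
  ((I ─ R) ∪ (R ∩ I)) ∪ ⁅ f ⁆  ≡⟨ cong (_∪ ⁅ f ⁆) (p─q∪q∩p≡p I R) ⟩
  I ∪ ⁅ f ⁆                    ∎
  where open ≡-Reasoning

record FirstExchange {n} (M₁ M₂ : Matroid n) (R I : Subset n) (f e : Fin n) : Set where
  field
    f∈R     : f ∈ R
    f∉I     : f ∉ I
    e∈I     : e ∈ I
    e∉R     : e ∉ R
    I+f∈₁   : Ind M₁ (I ∪ ⁅ f ⁆)
    I+f∉₂   : ¬ Ind M₂ (I ∪ ⁅ f ⁆)
    I-e+f∈₂ : Ind M₂ (I △ (⁅ f ⁆ ∪ ⁅ e ⁆))

path⇒first-exchange : ∀ {n} (M₁ M₂ : Matroid n) (R I : Subset n) {f e rest} →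
  STPath (DArc M₁ M₂ R I) (s ∷ el f ∷ el e ∷ rest) → FirstExchange M₁ M₂ R I f e
path⇒first-exchange M₁ M₂ R I {f} (_ , _ , (s→f , f→e , _) , _)
  with source-arc⁻ s→f
... | f∈R△I , f∉I─R , J+f∈₁ with exchange-arc⁻ f∉I─R f→e | x∈p△q⁻ R I f∈R△I
...   | _ | inj₂ (f∈I , f∉R) = ⊥-elim (f∉I─R (x∈p∧x∉q⇒x∈p─q f∈I f∉R))
...   | e∈I─R , J+f∉₂ , J+f-e∈₂ | inj₁ (f∈R , f∉I) = record
  { f∈R     = f∈R
  ; f∉I     = f∉I
  ; e∈I     = proj₁ (x∈p─q⁻ I R e∈I─R)
  ; e∉R     = proj₂ (x∈p─q⁻ I R e∈I─R)
  ; I+f∈₁   = subst (Ind M₁) (minor-extension R I f) J+f∈₁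
  ; I+f∉₂   = J+f∉₂ ∘ subst (Ind M₂) (sym (minor-extension R I f))
  ; I-e+f∈₂ = indep-⊆ M₂ (Swap.X⊆minor-exchange f∉I (proj₁ (x∈p─q⁻ I R e∈I─R)) R) J+f-e∈₂
  }

lemma4 : ∀ {n : ℕ} (M₁ M₂ : Matroid n) (R I : Subset n)
         (μ : Subset n → Subset n)
         → (∀ X → Common M₁ M₂ X → X ⊆ μ X × MaximalCommon M₁ M₂ (μ X))
         → MaximumCommon M₁ M₂ R
         → MaximalCommon M₁ M₂ I
         → ∣ I ∣ < ∣ R ∣
         → (v₂ v₃ : Fin n) (rest : List (Vertex n))
         → STPath (DArc M₁ M₂ R I) (s ∷ el v₂ ∷ el v₃ ∷ rest)
         → NoShortcuts (DArc M₁ M₂ R I) (s ∷ el v₂ ∷ el v₃ ∷ rest)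
         → ∣ I ∣ ≤ ∣ μ (I △ (⁅ v₂ ⁆ ∪ ⁅ v₃ ⁆)) ∣
           × ∣ R △ μ (I △ (⁅ v₂ ⁆ ∪ ⁅ v₃ ⁆)) ∣ < ∣ R △ I ∣
           × ∣ I △ μ (I △ (⁅ v₂ ⁆ ∪ ⁅ v₃ ⁆)) ∣ ≤ 3
-- Only the arcs (s, v₂) and (v₂, v₃) are used.
lemma4 M₁ M₂ R I μ μ-spec _ I-maximal _ f e _ path _ =
  ∣I∣≤∣Y∣ , ∣R△Y∣<∣R△I∣ f∈R e∉R , ∣I△Y∣≤3
  where
  open FirstExchange (path⇒first-exchange M₁ M₂ R I path)
  open Swap f∉I e∈I using (X; X⊆I∪⁅f⁆)

  X-common : Common M₁ M₂ X
  X-common = indep-⊆ M₁ X⊆I∪⁅f⁆ I+f∈₁ , I-e+f∈₂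

  open SingleExchange M₁ M₂ I-maximal f∉I e∈I I+f∈₁ I+f∉₂ {Y = μ X}
         (proj₁ (proj₂ (μ-spec X X-common))) (proj₁ (μ-spec X X-common))
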